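{- Every $123$-representable graph is a circle graph.
   Context: All graphs are simple. A circle graph is a graph whose vertices can be associated with chords of a circle so that two chords intersect if and only if the corresponding vertices are adjacent. A word is a finite sequence of letters from a totally ordered alphabet. Two letters $x,y$ alternate in a word $w$ if between any two occurrences of $x$ there is an occurrence of $y$ and between any two occurrences of $y$ there is an occurrence of $x$. A graph $G=(V,E)$ is represented by a word $w$ over $V$ if for all distinct $x,y\in V$, $x$ and $y$ alternate in $w$ if and only if $xy\in E$. A word contains the pattern $123$ if it has a strictly increasing subsequence of length $3$, and avoids $123$ otherwise. A graph is $123$-representable if, after labeling its vertices by distinct elements of a totally ordered set (any labeling may be chosen), it is represented by a $123$-avoiding word. -}

module Defs where

open import Data.Nat using (ℕ; _<_)
open import Data.Fin using (Fin)
import Data.Fin as F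
open import Data.List using (List; length; lookup)
open import Data.Product using (Σ; ∃; _×_; _,_)
open import Data.Sum using (_⊎_)
open import Relation.Binary.PropositionalEquality using (_≡_)
open import Relation.Nullary using (¬_)
open import Function.Definitions using (Injective)
open import Level using (0ℓ)
open import Agda.Primitive using (lsuc)

record Graph : Set₁ where
  field
    n     : ℕ
    Adj   : Fin n → Fin n → Set
    irrefl : ∀ x → ¬ Adj x x
    sym    : ∀ x y → Adj x y → Adj y x
open Graph public

_↔_ : Set → Set → Set
A ↔ B = (A → B) × (B → A)

Word : Set → Set
Word A = List A

Separates : {A : Set} → Word A → A → A → Set
Separates w x y =
  ∀ (i j : Fin (length w)) → i F.< j → lookup w i ≡ x → lookup w j ≡ x →
    Σ (Fin (length w)) λ k → (i F.< k) × (k F.< j) × (lookup w k ≡ y)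

Alternate : {A : Set} → Word A → A → A → Set
Alternate w x y = Separates w x y × Separates w y x

Represents : (G : Graph) → Word (Fin (n G)) → Set
Represents G w = ∀ (x y : Fin (n G)) → ¬ (x ≡ y) → Alternate w x y ↔ Adj G x y

Contains123 : {A : Set} → (A → ℕ) → Word A → Set
Contains123 ℓ w =
  Σ (Fin (length w)) λ i → Σ (Fin (length w)) λ j → Σ (Fin (length w)) λ k →
    (i F.< j) × (j F.< k) ×
    (ℓ (lookup w i) < ℓ (lookup w j)) × (ℓ (lookup w j) < ℓ (lookup w k))

Avoids123 : {A : Set} → (A → ℕ) → Word A → Set
Avoids123 ℓ w = ¬ Contains123 ℓ w

-- 123-representable: for some labeling of the vertices by distinct elements
-- of a totally ordered set (here: an injective labeling into ℕ), G is
-- represented by a 123-avoiding word.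
Is123Representable : Graph → Set
Is123Representable G =
  Σ (Fin (n G) → ℕ) λ ℓ → Injective _≡_ _≡_ ℓ ×
    Σ (Word (Fin (n G))) λ w → Represents G w × Avoids123 ℓ w

-- Points on the circle are described by their position
-- in the cyclic order (a natural number, reading the circle from a fixed
-- base point); a chord is a pair (a , b) of distinct points with a < b.
Chord : Set
Chord = Σ ℕ λ a → Σ ℕ λ b → a < b

-- Two chords (as closed segments) intersect iff they share an endpoint or
-- their endpoints interleave around the circle.
Intersect : Chord → Chord → Set
Intersect (a , b , _) (c , d , _) =
  (a ≡ c) ⊎ (a ≡ d) ⊎ (b ≡ c) ⊎ (b ≡ d) ⊎
  ((a < c) × (c < b) × (b < d)) ⊎ ((c < a) × (a < d) × (d < b))

IsCircleGraph : Graph → Set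
IsCircleGraph G =
  Σ (Fin (n G) → Chord) λ ch →
    ∀ (x y : Fin (n G)) → ¬ (x ≡ y) → Intersect (ch x) (ch y) ↔ Adj G x y

module Submission where

-- Letters
-- occurring at most once alternate with each other and with nothing occurring
-- three or more times; two letters occurring twice alternate iff their
-- occurrence pairs interleave, as chords do; and, the only use of
-- 123-avoidance, a letter occurring at least three times alternates with at
-- most one other letter.  So letters occurring twice span the marks of their
-- positions, letters occurring at most once are chords from the base point 0,
-- a frequent letter whose neighbour occurs twice is a short chord straddling
-- that neighbour's first mark, and the other frequent letters (isolated or in
-- matched pairs) are tiny chords far right, sharing an endpoint within a pair.

open import Defs
open import Data.Nat using (ℕ; suc; _+_; _*_; _∸_; _≤_; _<_; z≤n; s≤s; _⊓_)
import Data.Nat.Properties as NP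
open import Data.Fin as F using (Fin; toℕ)
import Data.Fin.Properties as FP
open import Data.List using (length; lookup)
open import Data.Product using (∃; _×_; _,_; proj₁; proj₂)
open import Data.Sum using (_⊎_; inj₁; inj₂)
open import Data.Empty using (⊥; ⊥-elim)
open import Relation.Binary.PropositionalEquality
  using (_≡_; refl; trans; cong; subst) renaming (sym to ≡-sym)
open import Relation.Binary.Definitions using (DecidableEquality; tri<; tri≈; tri>)
open import Relation.Nullary using (¬_; Dec; yes; no)
open import Relation.Nullary.Decidable using (_×-dec_; _→-dec_; ¬?)
open import Function.Definitions using (Injective)

left right : Chord → ℕ
left (a , _ , _) = a
right (_ , b , _) = b

chord : (a b : ℕ) → a < b → Chord
chord a b a<b = a , b , a<b

intersect-sym : ∀ u v → Intersect u v → Intersect v u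
intersect-sym _ _ (inj₁ e) = inj₁ (≡-sym e)
intersect-sym _ _ (inj₂ (inj₁ e)) = inj₂ (inj₂ (inj₁ (≡-sym e)))
intersect-sym _ _ (inj₂ (inj₂ (inj₁ e))) = inj₂ (inj₁ (≡-sym e))
intersect-sym _ _ (inj₂ (inj₂ (inj₂ (inj₁ e)))) = inj₂ (inj₂ (inj₂ (inj₁ (≡-sym e))))
intersect-sym _ _ (inj₂ (inj₂ (inj₂ (inj₂ (inj₁ c))))) = inj₂ (inj₂ (inj₂ (inj₂ (inj₂ c))))
intersect-sym _ _ (inj₂ (inj₂ (inj₂ (inj₂ (inj₂ c))))) = inj₂ (inj₂ (inj₂ (inj₂ (inj₁ c))))

interleave : ∀ u v → left u < left v → left v < right u → right u < right v → Intersect u v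
interleave (a , b , _) (c , d , _) ac cb bd = inj₂ (inj₂ (inj₂ (inj₂ (inj₁ (ac , cb , bd)))))

precedes-disjoint : ∀ u v → right u < left v → ¬ Intersect u v
precedes-disjoint (a , b , p) (c , d , q) bc (inj₁ refl) = NP.<-irrefl refl (NP.<-trans p bc)
precedes-disjoint (a , b , p) (c , d , q) bc (inj₂ (inj₁ refl)) =
  NP.<-irrefl refl (NP.<-trans p (NP.<-trans bc q))
precedes-disjoint (a , b , p) (c , d , q) bc (inj₂ (inj₂ (inj₁ refl))) = NP.<-irrefl refl bc
precedes-disjoint (a , b , p) (c , d , q) bc (inj₂ (inj₂ (inj₂ (inj₁ refl)))) =
  NP.<-irrefl refl (NP.<-trans bc q)
precedes-disjoint (a , b , p) (c , d , q) bc (inj₂ (inj₂ (inj₂ (inj₂ (inj₁ (_ , cb , _)))))) =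
  NP.<-asym bc cb
precedes-disjoint (a , b , p) (c , d , q) bc (inj₂ (inj₂ (inj₂ (inj₂ (inj₂ (ca , _ , _)))))) =
  NP.<-asym (NP.<-trans p bc) ca

follows-disjoint : ∀ u v → right v < left u → ¬ Intersect u v
follows-disjoint u v h i = precedes-disjoint v u h (intersect-sym u v i)

contains-disjoint : ∀ u v → left u < left v → right v < right u → ¬ Intersect u v
contains-disjoint (a , b , p) (c , d , q) ac db (inj₁ refl) = NP.<-irrefl refl ac
contains-disjoint (a , b , p) (c , d , q) ac db (inj₂ (inj₁ refl)) =
  NP.<-irrefl refl (NP.<-trans ac q)
contains-disjoint (a , b , p) (c , d , q) ac db (inj₂ (inj₂ (inj₁ refl))) =
  NP.<-irrefl refl (NP.<-trans q db)
contains-disjoint (a , b , p) (c , d , q) ac db (inj₂ (inj₂ (inj₂ (inj₁ refl)))) = NP.<-irrefl refl db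
contains-disjoint (a , b , p) (c , d , q) ac db (inj₂ (inj₂ (inj₂ (inj₂ (inj₁ (_ , _ , bd)))))) =
  NP.<-asym bd db
contains-disjoint (a , b , p) (c , d , q) ac db (inj₂ (inj₂ (inj₂ (inj₂ (inj₂ (ca , _ , _)))))) =
  NP.<-asym ac ca

inside-disjoint : ∀ u v → left v < left u → right u < right v → ¬ Intersect u v
inside-disjoint u v ca bd i = contains-disjoint v u ca bd (intersect-sym u v i)

-- Occurrences and alternation in an arbitrary word

module Occurrences {A : Set} (_≟_ : DecidableEquality A) (w : Word A) where

  Pos : Set
  Pos = Fin (length w)

  Occ : A → Pos → Set
  Occ x i = lookup w i ≡ x

  occ? : ∀ x i → Dec (Occ x i)
  occ? x i = lookup w i ≟ x

  Absent : A → Set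
  Absent x = ∀ i → ¬ Occ x i

  record Once (x : A) : Set where
    constructor once
    field
      pos  : Pos
      occ  : Occ x pos
      only : ∀ i → Occ x i → i ≡ pos

  record Twice (x : A) : Set where
    constructor twice
    field
      q1 q2 : Pos
      q1<q2 : q1 F.< q2
      o1    : Occ x q1
      o2    : Occ x q2
      only  : ∀ i → Occ x i → i ≡ q1 ⊎ i ≡ q2

  record Often (x : A) : Set where
    constructor often
    field
      p1 p2 p3 : Pos
      p1<p2    : p1 F.< p2
      p2<p3    : p2 F.< p3
      o1       : Occ x p1
      o2       : Occ x p2
      o3       : Occ x p3

  data Occurrences (x : A) : Set where
    absent : Absent x → Occurrences x
    single : Once x → Occurrences x
    double : Twice x → Occurrences x
    many   : Often x → Occurrences x

  occurrences : ∀ x → Occurrences x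
  occurrences x with FP.any? (λ i → FP.any? λ j → FP.any? λ k →
                       (i FP.<? j) ×-dec (j FP.<? k) ×-dec occ? x i ×-dec occ? x j ×-dec occ? x k)
  ... | yes (i , j , k , ij , jk , oi , oj , ok) = many (often i j k ij jk oi oj ok)
  ... | no ¬three with FP.any? (λ i → FP.any? λ j → (i FP.<? j) ×-dec occ? x i ×-dec occ? x j)
  ... | yes (i , j , ij , oi , oj) = double (twice i j ij oi oj only)
    where
    only : ∀ k → Occ x k → k ≡ i ⊎ k ≡ j
    only k ok with FP.<-cmp k i
    ... | tri< k<i _ _ = ⊥-elim (¬three (k , i , j , k<i , ij , ok , oi , oj))
    ... | tri≈ _ e _ = inj₁ e
    ... | tri> _ _ i<k with FP.<-cmp k j
    ... | tri< k<j _ _ = ⊥-elim (¬three (i , k , j , i<k , k<j , oi , ok , oj))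
    ... | tri≈ _ e _ = inj₂ e
    ... | tri> _ _ j<k = ⊥-elim (¬three (i , j , k , ij , j<k , oi , oj , ok))
  ... | no ¬two with FP.any? (occ? x)
  ... | yes (p , op) = single (once p op only)
    where
    only : ∀ k → Occ x k → k ≡ p
    only k ok with FP.<-cmp k p
    ... | tri< k<p _ _ = ⊥-elim (¬two (k , p , k<p , ok , op))
    ... | tri≈ _ e _ = e
    ... | tri> _ _ p<k = ⊥-elim (¬two (p , k , p<k , op , ok))
  ... | no ¬one = absent λ i oi → ¬one (i , oi)

  Alt : A → A → Set
  Alt = Alternate w

  alt-sym : ∀ {x y} → Alt x y → Alt y x
  alt-sym (s , s') = s' , s

  alt? : ∀ x y → Dec (Alt x y)
  alt? x y = separates? x y ×-dec separates? y x
    where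
    separates? : ∀ x y → Dec (Separates w x y)
    separates? x y = FP.all? λ i → FP.all? λ j → (i FP.<? j) →-dec occ? x i →-dec occ? x j →-dec
                       FP.any? (λ k → (i FP.<? k) ×-dec (k FP.<? j) ×-dec occ? y k)

  AtMostOnce : A → Set
  AtMostOnce y = ∀ i j → Occ y i → Occ y j → i ≡ j

  absent-atMostOnce : ∀ {y} → Absent y → AtMostOnce y
  absent-atMostOnce a i _ oi _ = ⊥-elim (a i oi)

  once-atMostOnce : ∀ {y} → Once y → AtMostOnce y
  once-atMostOnce (once _ _ only) i j oi oj = trans (only i oi) (≡-sym (only j oj))

  sparse-separated : ∀ {x y} → AtMostOnce x → Separates w x y
  sparse-separated amo i j i<j oi oj = ⊥-elim (FP.<-irrefl (amo i j oi oj) i<j)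

  -- Three occurrences of x need two distinct occurrences of a separator.
  often-not-separated : ∀ {x y} → Often x → AtMostOnce y → ¬ Separates w x y
  often-not-separated (often p1 p2 p3 p1<p2 p2<p3 o1 o2 o3) amo s
    with s p1 p2 p1<p2 o1 o2 | s p2 p3 p2<p3 o2 o3
  ... | k1 , _ , k1<p2 , ok1 | k2 , p2<k2 , _ , ok2 =
    FP.<-irrefl (amo k1 k2 ok1 ok2) (NP.<-trans k1<p2 p2<k2)

  twice-not-separated : ∀ {x y} → Twice x → Absent y → ¬ Separates w x y
  twice-not-separated (twice q1 q2 q1<q2 o1 o2 _) a s with s q1 q2 q1<q2 o1 o2
  ... | k , _ , _ , ok = a k ok

  twice-pair : ∀ {x} (t : Twice x) {i j} → i F.< j → Occ x i → Occ x j →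
               (i ≡ Twice.q1 t) × (j ≡ Twice.q2 t)
  twice-pair (twice q1 q2 q1<q2 _ _ only) {i} {j} i<j oi oj with only i oi | only j oj
  ... | inj₁ e1 | inj₂ e2 = e1 , e2
  ... | inj₁ refl | inj₁ refl = ⊥-elim (FP.<-irrefl refl i<j)
  ... | inj₂ refl | inj₁ refl = ⊥-elim (NP.<-asym i<j q1<q2)
  ... | inj₂ refl | inj₂ refl = ⊥-elim (FP.<-irrefl refl i<j)

  twice-separated : ∀ {x y} (t : Twice x) k → Twice.q1 t F.< k → k F.< Twice.q2 t → Occ y k →
                    Separates w x y
  twice-separated t k a b ok i j i<j oi oj with twice-pair t i<j oi oj
  ... | refl , refl = k , a , b , ok

  twice-first-unique : ∀ {x} (t t' : Twice x) → Twice.q1 t ≡ Twice.q1 t'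
  twice-first-unique (twice q1 q2 q1<q2 o1 _ only) (twice r1 r2 r1<r2 o1' _ only')
    with only' q1 o1 | only r1 o1'
  ... | inj₁ e | _ = e
  ... | inj₂ refl | inj₁ refl = refl
  ... | inj₂ refl | inj₂ refl = ⊥-elim (NP.<-asym q1<q2 r1<r2)

  once-not-twice : ∀ {x} → Once x → ¬ Twice x
  once-not-twice (once _ _ only) (twice q1 q2 q1<q2 o1 o2 _) =
    FP.<-irrefl (trans (only q1 o1) (≡-sym (only q2 o2))) q1<q2

  twice-not-often : ∀ {x} → Twice x → ¬ Often x
  twice-not-often (twice _ _ q1<q2 _ _ only) (often p1 p2 p3 p1<p2 p2<p3 o1 o2 o3)
    with only p1 o1 | only p2 o2 | only p3 o3
  ... | inj₁ refl | inj₁ refl | _ = FP.<-irrefl refl p1<p2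
  ... | inj₁ refl | inj₂ refl | inj₁ refl = NP.<-asym q1<q2 p2<p3
  ... | inj₁ refl | inj₂ refl | inj₂ refl = FP.<-irrefl refl p2<p3
  ... | inj₂ refl | inj₁ refl | _ = NP.<-asym q1<q2 p1<p2
  ... | inj₂ refl | inj₂ refl | _ = FP.<-irrefl refl p1<p2

  distinct-positions : ∀ {x y i j} → Occ x i → Occ y j → ¬ x ≡ y → ¬ i ≡ j
  distinct-positions ox oy x≢y refl = x≢y (trans (≡-sym ox) oy)

-- The 123-avoidance lemma: a letter occurring at least three times
-- alternates with at most one other letter.

module Avoiding {A : Set} (_≟_ : DecidableEquality A) (ℓ : A → ℕ) (ℓ-inj : Injective _≡_ _≡_ ℓ)
                (w : Word A) (avoids : Avoids123 ℓ w) where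
  open Occurrences _≟_ w

  no123 : ∀ i j k {u v t} → i F.< j → j F.< k → Occ u i → Occ v j → Occ t k →
          ℓ u < ℓ v → ℓ v < ℓ t → ⊥
  no123 i j k i<j j<k refl refl refl uv vt = avoids (i , j , k , i<j , j<k , uv , vt)

  -- If x occurs at p1 < p2 < p3 and alternates with a ≠ b, then a and b both
  -- occur in (p1,p2) and in (p2,p3); comparing ℓ x, ℓ a, ℓ b always yields a
  -- 123 pattern among these five positions.
  unique-neighbour : ∀ {x a b} → Often x → Alt x a → Alt x b → ¬ a ≡ x → ¬ b ≡ x → a ≡ b
  unique-neighbour {x} {a} {b} (often p1 p2 p3 p1<p2 p2<p3 o1 o2 o3) (sa , _) (sb , _) a≢x b≢x
    with a ≟ b
  ... | yes e = e
  ... | no a≢b with sa p1 p2 p1<p2 o1 o2 | sa p2 p3 p2<p3 o2 o3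
                  | sb p1 p2 p1<p2 o1 o2 | sb p2 p3 p2<p3 o2 o3
  ... | a1 , p1a1 , a1p2 , oa1 | a2 , p2a2 , a2p3 , oa2
      | b1 , p1b1 , b1p2 , ob1 | b2 , p2b2 , b2p3 , ob2
    with NP.<-cmp (ℓ x) (ℓ a) | NP.<-cmp (ℓ x) (ℓ b) | NP.<-cmp (ℓ a) (ℓ b)
  ... | tri≈ _ e _ | _ | _ = ⊥-elim (a≢x (≡-sym (ℓ-inj e)))
  ... | _ | tri≈ _ e _ | _ = ⊥-elim (b≢x (≡-sym (ℓ-inj e)))
  ... | _ | _ | tri≈ _ e _ = ⊥-elim (a≢b (ℓ-inj e))
  ... | tri< xa _ _ | tri< _ _ _ | tri< a<b _ _ =
    ⊥-elim (no123 p1 a1 b2 p1a1 (NP.<-trans a1p2 p2b2) o1 oa1 ob2 xa a<b)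
  ... | tri< _ _ _ | tri< xb _ _ | tri> _ _ b<a =
    ⊥-elim (no123 p1 b1 a2 p1b1 (NP.<-trans b1p2 p2a2) o1 ob1 oa2 xb b<a)
  ... | tri> _ _ a<x | tri< xb _ _ | _ =
    ⊥-elim (no123 a1 p2 b2 a1p2 p2b2 oa1 o2 ob2 a<x xb)
  ... | tri< xa _ _ | tri> _ _ b<x | _ =
    ⊥-elim (no123 b1 p2 a2 b1p2 p2a2 ob1 o2 oa2 b<x xa)
  ... | tri> _ _ _ | tri> _ _ b<x | tri< a<b _ _ =
    ⊥-elim (no123 a1 b2 p3 (NP.<-trans a1p2 p2b2) b2p3 oa1 ob2 o3 a<b b<x)
  ... | tri> _ _ a<x | tri> _ _ _ | tri> _ _ b<a =
    ⊥-elim (no123 b1 a2 p3 (NP.<-trans b1p2 p2a2) a2p3 ob1 oa2 o3 b<a a<x)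

-- Numeric layout of the chord endpoints, for m letters and L positions.
-- Position q owns the block [block q, block q + K); inside it the mark of q
-- sits in the middle, surrounded by the nested points inner x q < mark q <
-- outer x q (the larger x, the wider the pair).  The points pairPoint k lie
-- beyond all blocks and are two apart.

module Layout (m L : ℕ) where
  N K B : ℕ
  N = suc m
  K = N + N
  B = suc L * K

  block mark : Fin L → ℕ
  block q = suc (toℕ q) * K
  mark q = block q + N

  inner outer : Fin m → Fin L → ℕ
  inner x q = block q + (m ∸ toℕ x)
  outer x q = block q + (N + suc (toℕ x))

  pairPoint : ℕ → ℕ
  pairPoint k = B + (k + k)

  block-step : ∀ {q q'} → q F.< q' → block q + K ≤ block q'
  block-step {q} {q'} q<q' = subst (_≤ block q') (NP.+-comm K (block q)) (NP.*-monoˡ-≤ K (s≤s q<q'))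

  block-end≤B : ∀ q → block q + K ≤ B
  block-end≤B q = subst (_≤ B) (NP.+-comm K (block q)) (NP.*-monoˡ-≤ K (s≤s (FP.toℕ<n q)))

  K≤block : ∀ q → K ≤ block q
  K≤block q = NP.m≤m+n K _

  mark-in : ∀ q → mark q < block q + K
  mark-in q = NP.+-monoʳ-< (block q) (NP.m<m+n N (s≤s z≤n))

  outer-in : ∀ x q → outer x q < block q + K
  outer-in x q = NP.+-monoʳ-< (block q) (NP.+-monoʳ-< N (s≤s (FP.toℕ<n x)))

  block≤mark : ∀ q → block q ≤ mark q
  block≤mark q = NP.m≤m+n _ _

  block≤inner : ∀ x q → block q ≤ inner x q
  block≤inner x q = NP.m≤m+n _ _

  inner<mark : ∀ x q → inner x q < mark q
  inner<mark x q = NP.+-monoʳ-< (block q) (s≤s (NP.m∸n≤m m (toℕ x)))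

  mark<outer : ∀ x q → mark q < outer x q
  mark<outer x q = NP.+-monoʳ-< (block q) (NP.m<m+n N (s≤s z≤n))

  inner<outer : ∀ x q → inner x q < outer x q
  inner<outer x q = NP.<-trans (inner<mark x q) (mark<outer x q)

  inner-nest : ∀ {x x'} q → x F.< x' → inner x' q < inner x q
  inner-nest {x} {x'} q x<x' = NP.+-monoʳ-< (block q) (NP.∸-monoʳ-< x<x' (NP.<⇒≤ (FP.toℕ<n x')))

  outer-nest : ∀ {x x'} q → x F.< x' → outer x q < outer x' q
  outer-nest q x<x' = NP.+-monoʳ-< (block q) (NP.+-monoʳ-< N (s≤s x<x'))

  across : ∀ {q q' a b} → a < block q + K → q F.< q' → block q' ≤ b → a < b
  across a< q<q' ≤b = NP.<-≤-trans a< (NP.≤-trans (block-step q<q') ≤b)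

  below-B : ∀ {q a} → a < block q + K → a < B
  below-B {q} a< = NP.<-≤-trans a< (block-end≤B q)

  below-pairPoint : ∀ {a} k → a < B → a < pairPoint k
  below-pairPoint k a< = NP.<-≤-trans a< (NP.m≤m+n B (k + k))

  -- The points 1 .. m, used by absent letters, lie before every block.
  letter<K : ∀ (z : Fin m) → suc (toℕ z) < K
  letter<K z = NP.<-≤-trans (s≤s (FP.toℕ<n z)) (NP.m≤m+n N N)

  letter<block : ∀ (z : Fin m) q {b} → block q ≤ b → suc (toℕ z) < b
  letter<block z q ≤b = NP.<-≤-trans (letter<K z) (NP.≤-trans (K≤block q) ≤b)

  letter<B : ∀ (z : Fin m) → suc (toℕ z) < B
  letter<B z = NP.<-≤-trans (letter<K z) (NP.m≤m+n K (L * K))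

  pairPoint-step : ∀ {k k'} → k < k' → suc (pairPoint k) < pairPoint k'
  pairPoint-step {k} {k'} k<k' = subst (λ n → suc n ≤ pairPoint k') (NP.+-suc B (k + k))
    (NP.+-monoʳ-< B (subst (_≤ k' + k') (cong suc (NP.+-suc k k)) (NP.+-mono-≤ k<k' k<k')))

  mark-mono : ∀ {q q'} → q F.< q' → mark q < mark q'
  mark-mono {q} {q'} q<q' = across (mark-in q) q<q' (block≤mark q')

  mark-reflects : ∀ {a b} → mark a < mark b → a F.< b
  mark-reflects {a} {b} lt with FP.<-cmp a b
  ... | tri< a<b _ _ = a<b
  ... | tri≈ _ refl _ = ⊥-elim (NP.<-irrefl refl lt)
  ... | tri> _ _ b<a = ⊥-elim (NP.<-asym lt (mark-mono b<a))

  mark-injective : ∀ {a b} → mark a ≡ mark b → a ≡ b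
  mark-injective {a} {b} e with FP.<-cmp a b
  ... | tri< a<b _ _ = ⊥-elim (NP.<-irrefl e (mark-mono a<b))
  ... | tri≈ _ a≡b _ = a≡b
  ... | tri> _ _ b<a = ⊥-elim (NP.<-irrefl (≡-sym e) (mark-mono b<a))

  0<mark : ∀ q → 0 < mark q
  0<mark q = NP.<-≤-trans (s≤s z≤n) (NP.≤-trans (K≤block q) (block≤mark q))

  0≢mark : ∀ q → ¬ 0 ≡ mark q
  0≢mark q e = NP.<-irrefl e (0<mark q)

  straddles : ∀ x {q q'} (q<q' : q F.< q') →
              Intersect (chord (mark q) (mark q') (mark-mono q<q')) (chord (inner x q) (outer x q) (inner<outer x q))
  straddles x {q} {q'} q<q' = intersect-sym v u (interleave v u (inner<mark x q) (mark<outer x q)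
                                                  (across (outer-in x q) q<q' (block≤mark q')))
    where
    u = chord (mark q) (mark q') (mark-mono q<q')
    v = chord (inner x q) (outer x q) (inner<outer x q)

  0<inner : ∀ x q → 0 < inner x q
  0<inner x q = NP.<-≤-trans (s≤s z≤n) (NP.≤-trans (K≤block q) (block≤inner x q))

-- The chord model of a graph represented by a 123-avoiding word

module Construction (G : Graph) (ℓ : Fin (n G) → ℕ) (ℓ-inj : Injective _≡_ _≡_ ℓ)
                    (w : Word (Fin (n G))) (rep : Represents G w) (avoids : Avoids123 ℓ w) where
  open Occurrences F._≟_ w
  open Avoiding F._≟_ ℓ ℓ-inj w avoids
  open Layout (n G) (length w)

  Letter : Set
  Letter = Fin (n G)

  -- A frequent letter has no neighbour, or one, which we record when it is
  -- frequent too.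
  data Partner (x : Letter) : Set where
    isolated : (∀ z → ¬ z ≡ x → ¬ Alt x z) → Partner x
    matched  : (r : Letter) → ¬ r ≡ x → Alt x r → Often r → Partner x

  key : ∀ {x} → Partner x → ℕ
  key {x} (isolated _) = toℕ x
  key {x} (matched r _ _ _) = toℕ x ⊓ toℕ r

  record Pendant (x : Letter) : Set where
    constructor pendant
    field
      frequent    : Often x
      anchor      : Letter
      anchor≢x    : ¬ anchor ≡ x
      alternates  : Alt x anchor
      anchorTwice : Twice anchor

    -- the position whose block holds the chord of x
    site : Pos
    site = Twice.q1 anchorTwice

  data Kind (x : Letter) : Set where
    isAbsent  : Absent x → Kind x
    isOnce    : Once x → Kind x
    isTwice   : Twice x → Kind x
    isPendant : Pendant x → Kind x
    isRemote  : Often x → Partner x → Kind x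

  chordOf : ∀ {x} → Kind x → Chord
  chordOf {x} (isAbsent _) = chord 0 (suc (toℕ x)) (s≤s z≤n)
  chordOf (isOnce (once p _ _)) = chord 0 (mark p) (0<mark p)
  chordOf (isTwice (twice q1 q2 q1<q2 _ _ _)) = chord (mark q1) (mark q2) (mark-mono q1<q2)
  chordOf {x} (isPendant pd) = chord (inner x s) (outer x s) (inner<outer x s)
    where s = Pendant.site pd
  chordOf (isRemote _ p) = chord (pairPoint (key p)) (suc (pairPoint (key p))) NP.≤-refl

  record Faithful {x y : Letter} (kx : Kind x) (ky : Kind y) : Set where
    constructor _,_
    field
      sound    : Intersect (chordOf kx) (chordOf ky) → Alt x y
      complete : Alt x y → Intersect (chordOf kx) (chordOf ky)

  faithful-sym : ∀ {x y} {kx : Kind x} {ky : Kind y} → Faithful kx ky → Faithful ky kx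
  faithful-sym {kx = kx} {ky} (s , c) =
    (λ i → alt-sym (s (intersect-sym (chordOf ky) (chordOf kx) i))) ,
    (λ a → intersect-sym (chordOf kx) (chordOf ky) (c (alt-sym a)))

  both : ∀ {x y} {kx : Kind x} {ky : Kind y} → Intersect (chordOf kx) (chordOf ky) → Alt x y →
         Faithful kx ky
  both i a = (λ _ → a) , (λ _ → i)

  neither : ∀ {x y} {kx : Kind x} {ky : Kind y} → ¬ Intersect (chordOf kx) (chordOf ky) →
            ¬ Alt x y → Faithful kx ky
  neither ¬i ¬a = (λ i → ⊥-elim (¬i i)) , (λ a → ⊥-elim (¬a a))

  precedes-neither : ∀ {x y} {kx : Kind x} {ky : Kind y} → right (chordOf kx) < left (chordOf ky) →
                     ¬ Alt x y → Faithful kx ky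
  precedes-neither {kx = kx} {ky} h = neither (precedes-disjoint (chordOf kx) (chordOf ky) h)

  sparse-sparse : ∀ {x y} {kx : Kind x} {ky : Kind y} → AtMostOnce x → AtMostOnce y →
                  left (chordOf kx) ≡ left (chordOf ky) → Faithful kx ky
  sparse-sparse ax ay e = both (inj₁ e) (sparse-separated ax , sparse-separated ay)

  -- An absent letter's chord ends before every block and it alternates
  -- with no letter occurring at least twice.
  absent-twice : ∀ {x y} (a : Absent x) (t : Twice y) → Faithful (isAbsent a) (isTwice t)
  absent-twice {x} a t = precedes-neither (letter<block x (Twice.q1 t) (block≤mark (Twice.q1 t)))
    λ al → twice-not-separated t a (proj₂ al)

  absent-pendant : ∀ {x y} (a : Absent x) (pd : Pendant y) → Faithful (isAbsent a) (isPendant pd)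
  absent-pendant {x} {y} a pd =
    precedes-neither (letter<block x (Pendant.site pd) (block≤inner y (Pendant.site pd)))
      λ al → often-not-separated (Pendant.frequent pd) (absent-atMostOnce a) (proj₂ al)

  absent-remote : ∀ {x y} (a : Absent x) (m : Often y) (p : Partner y) → Faithful (isAbsent a) (isRemote m p)
  absent-remote {x} a m p = precedes-neither (below-pairPoint (key p) (letter<B x))
    λ al → often-not-separated m (absent-atMostOnce a) (proj₂ al)

  -- A single occurrence alternates with a double letter iff it lies between
  -- its two occurrences, i.e. iff the marks interleave.
  once-twice : ∀ {x y} → ¬ x ≡ y → (o : Once x) (t : Twice y) → Faithful (isOnce o) (isTwice t)
  once-twice {x} {y} x≢y o@(once p op only) t@(twice q1 q2 q1<q2 o1 o2 _) = sound , complete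
    where
    sound : Intersect (chordOf (isOnce o)) (chordOf (isTwice t)) → Alt x y
    sound (inj₁ e) = ⊥-elim (0≢mark q1 e)
    sound (inj₂ (inj₁ e)) = ⊥-elim (0≢mark q2 e)
    sound (inj₂ (inj₂ (inj₁ e))) = ⊥-elim (distinct-positions op o1 x≢y (mark-injective e))
    sound (inj₂ (inj₂ (inj₂ (inj₁ e)))) = ⊥-elim (distinct-positions op o2 x≢y (mark-injective e))
    sound (inj₂ (inj₂ (inj₂ (inj₂ (inj₁ (_ , q1<p , p<q2)))))) =
      sparse-separated (once-atMostOnce o) , twice-separated t p (mark-reflects q1<p) (mark-reflects p<q2) op
    sound (inj₂ (inj₂ (inj₂ (inj₂ (inj₂ (() , _ , _))))))
    complete : Alt x y → Intersect (chordOf (isOnce o)) (chordOf (isTwice t))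
    complete (_ , s) with s q1 q2 q1<q2 o1 o2
    ... | k , q1<k , k<q2 , ok with only k ok
    ... | refl = interleave (chordOf (isOnce o)) (chordOf (isTwice t)) (0<mark q1) (mark-mono q1<k) (mark-mono k<q2)

  -- A pendant chord sits inside one block: a chord from 0 either ends before
  -- that block or contains it.
  once-pendant : ∀ {x y} (o : Once x) (pd : Pendant y) → Faithful (isOnce o) (isPendant pd)
  once-pendant {x} {y} o@(once p op only) pd =
    neither disjoint λ al → often-not-separated (Pendant.frequent pd) (once-atMostOnce o) (proj₂ al)
    where
    open Pendant pd
    u = chordOf (isOnce o)
    v = chordOf (isPendant pd)
    disjoint : ¬ Intersect u v
    disjoint with FP.<-cmp p site
    ... | tri< p<s _ _ = precedes-disjoint u v (across (mark-in p) p<s (block≤inner y site))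
    ... | tri> _ _ s<p = contains-disjoint u v (0<inner y site) (across (outer-in y site) s<p (block≤mark p))
    ... | tri≈ _ refl _ = ⊥-elim (once-not-twice o (subst Twice anchor≡x anchorTwice))
      where
      -- x occurs at the site, where the anchor occurs
      anchor≡x : anchor ≡ x
      anchor≡x = trans (≡-sym (Twice.o1 anchorTwice)) op

  once-remote : ∀ {x y} (o : Once x) (m : Often y) (p : Partner y) → Faithful (isOnce o) (isRemote m p)
  once-remote o@(once q _ _) m p = precedes-neither (below-pairPoint (key p) (below-B {q} (mark-in q)))
    λ al → often-not-separated m (once-atMostOnce o) (proj₂ al)

  -- Two double letters alternate iff their occurrence pairs interleave.
  twice-twice : ∀ {x y} → ¬ x ≡ y → (tx : Twice x) (ty : Twice y) → Faithful (isTwice tx) (isTwice ty)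
  twice-twice {x} {y} x≢y tx@(twice q1 q2 q1<q2 o1 o2 only) ty@(twice r1 r2 r1<r2 o1' o2' only') =
    sound , complete
    where
    u = chordOf (isTwice tx)
    v = chordOf (isTwice ty)
    sound : Intersect u v → Alt x y
    sound (inj₁ e) = ⊥-elim (distinct-positions o1 o1' x≢y (mark-injective e))
    sound (inj₂ (inj₁ e)) = ⊥-elim (distinct-positions o1 o2' x≢y (mark-injective e))
    sound (inj₂ (inj₂ (inj₁ e))) = ⊥-elim (distinct-positions o2 o1' x≢y (mark-injective e))
    sound (inj₂ (inj₂ (inj₂ (inj₁ e)))) = ⊥-elim (distinct-positions o2 o2' x≢y (mark-injective e))
    sound (inj₂ (inj₂ (inj₂ (inj₂ (inj₁ (a , b , c)))))) =
      twice-separated tx r1 (mark-reflects a) (mark-reflects b) o1' ,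
      twice-separated ty q2 (mark-reflects b) (mark-reflects c) o2
    sound (inj₂ (inj₂ (inj₂ (inj₂ (inj₂ (a , b , c)))))) =
      twice-separated tx r2 (mark-reflects b) (mark-reflects c) o2' ,
      twice-separated ty q1 (mark-reflects a) (mark-reflects b) o1
    complete : Alt x y → Intersect u v
    complete (s , s') with s q1 q2 q1<q2 o1 o2 | s' r1 r2 r1<r2 o1' o2'
    ... | k , a , b , ok | k' , a' , b' , ok' with only' k ok | only k' ok'
    ... | inj₁ refl | inj₁ refl = ⊥-elim (NP.<-asym a a')
    ... | inj₁ refl | inj₂ refl = interleave u v (mark-mono a) (mark-mono b) (mark-mono b')
    ... | inj₂ refl | inj₁ refl = intersect-sym v u (interleave v u (mark-mono a') (mark-mono a) (mark-mono b))
    ... | inj₂ refl | inj₂ refl = ⊥-elim (NP.<-asym b b')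

  -- A pendant chord crosses the chord of its own anchor (it straddles the
  -- anchor's first mark) and lies strictly inside or outside any other.
  twice-pendant : ∀ {x y} → ¬ x ≡ y → (tx : Twice x) (pd : Pendant y) →
                  Faithful (isTwice tx) (isPendant pd)
  twice-pendant {x} {y} x≢y tx@(twice q1 q2 q1<q2 o1 o2 _) pd@(pendant m t t≢y at tw) with x F.≟ t
  ... | yes refl = both crossing (alt-sym at)
    where
    crossing : Intersect (chordOf (isTwice tx)) (chordOf (isPendant pd))
    crossing = subst (λ s → Intersect (chordOf (isTwice tx)) (chord (inner y s) (outer y s) (inner<outer y s)))
                     (twice-first-unique tx tw) (straddles y q1<q2)
  ... | no x≢t = neither disjoint λ a → x≢t (unique-neighbour m (alt-sym a) at x≢y t≢y)
    where
    s = Pendant.site pd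
    u = chordOf (isTwice tx)
    v = chordOf (isPendant pd)
    disjoint : ¬ Intersect u v
    disjoint with FP.<-cmp s q1
    ... | tri< s<q1 _ _ = follows-disjoint u v (across (outer-in y s) s<q1 (block≤mark q1))
    ... | tri≈ _ e _ = ⊥-elim (distinct-positions o1 (Twice.o1 tw) x≢t (≡-sym e))
    ... | tri> _ _ q1<s with FP.<-cmp s q2
    ... | tri< s<q2 _ _ =
      contains-disjoint u v (across (mark-in q1) q1<s (block≤inner y s))
                            (across (outer-in y s) s<q2 (block≤mark q2))
    ... | tri≈ _ e _ = ⊥-elim (distinct-positions o2 (Twice.o1 tw) x≢t (≡-sym e))
    ... | tri> _ _ q2<s = precedes-disjoint u v (across (mark-in q2) q2<s (block≤inner y s))

  neighbour-of-remote : ∀ {x y} → Often y → Partner y → ¬ x ≡ y → Alt y x → Often x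
  neighbour-of-remote m (isolated none) x≢y a = ⊥-elim (none _ x≢y a)
  neighbour-of-remote m (matched r r≢y ar mr) x≢y a with unique-neighbour m a ar x≢y r≢y
  ... | refl = mr

  twice-remote : ∀ {x y} → ¬ x ≡ y → (t : Twice x) (m : Often y) (p : Partner y) →
                 Faithful (isTwice t) (isRemote m p)
  twice-remote x≢y t m p =
    precedes-neither (below-pairPoint (key p) (below-B {Twice.q2 t} (mark-in (Twice.q2 t))))
      λ a → twice-not-often t (neighbour-of-remote m p x≢y (alt-sym a))

  -- A pendant letter alternates with no other frequent letter: its unique
  -- neighbour occurs twice.
  pendant-not-alternating : ∀ {x y} → ¬ x ≡ y → Pendant x → Often y → ¬ Alt x y
  pendant-not-alternating x≢y (pendant m t t≢x at tw) my a
    with unique-neighbour m a at (λ e → x≢y (≡-sym e)) t≢x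
  ... | refl = twice-not-often tw my

  -- Pendant chords in the same block are nested, in distinct blocks disjoint.
  pendant-pendant : ∀ {x y} → ¬ x ≡ y → (px : Pendant x) (py : Pendant y) →
                    Faithful (isPendant px) (isPendant py)
  pendant-pendant {x} {y} x≢y px py =
    neither disjoint (pendant-not-alternating x≢y px (Pendant.frequent py))
    where
    s = Pendant.site px
    s' = Pendant.site py
    u = chordOf (isPendant px)
    v = chordOf (isPendant py)
    disjoint : ¬ Intersect u v
    disjoint with FP.<-cmp s s' | FP.<-cmp x y
    ... | tri< s<s' _ _ | _ = precedes-disjoint u v (across (outer-in x s) s<s' (block≤inner y s'))
    ... | tri> _ _ s'<s | _ = follows-disjoint u v (across (outer-in y s') s'<s (block≤inner x s))
    ... | tri≈ _ refl _ | tri< x<y _ _ = inside-disjoint u v (inner-nest s x<y) (outer-nest s x<y)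
    ... | tri≈ _ refl _ | tri≈ _ x≡y _ = ⊥-elim (x≢y x≡y)
    ... | tri≈ _ refl _ | tri> _ _ y<x = contains-disjoint u v (inner-nest s y<x) (outer-nest s y<x)

  pendant-remote : ∀ {x y} → ¬ x ≡ y → (px : Pendant x) (m : Often y) (p : Partner y) →
                   Faithful (isPendant px) (isRemote m p)
  pendant-remote {x} x≢y px m p =
    precedes-neither (below-pairPoint (key p) (below-B {Pendant.site px} (outer-in x (Pendant.site px))))
      (pendant-not-alternating x≢y px m)

  -- Two distinct frequent letters alternate iff they are matched partners,
  -- iff their keys coincide.
  alternating-same-key : ∀ {x y} → ¬ x ≡ y → Often x → Often y → (px : Partner x) (py : Partner y) →
                         Alt x y → key px ≡ key py
  alternating-same-key x≢y _ _ (isolated none) _ a = ⊥-elim (none _ (λ e → x≢y (≡-sym e)) a)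
  alternating-same-key x≢y _ _ (matched _ _ _ _) (isolated none) a = ⊥-elim (none _ x≢y (alt-sym a))
  alternating-same-key {x} {y} x≢y mx my (matched r r≢x ar _) (matched s s≢y as _) a
    with unique-neighbour mx a ar (λ e → x≢y (≡-sym e)) r≢x
       | unique-neighbour my (alt-sym a) as x≢y s≢y
  ... | refl | refl = NP.⊓-comm (toℕ x) (toℕ y)

  key-letter : ∀ {x} (p : Partner x) →
               key p ≡ toℕ x ⊎ ∃ λ r → Often r × Alt x r × ¬ r ≡ x × key p ≡ toℕ r
  key-letter (isolated _) = inj₁ refl
  key-letter {x} (matched r r≢x ar mr) with NP.⊓-sel (toℕ x) (toℕ r)
  ... | inj₁ e = inj₁ e
  ... | inj₂ e = inj₂ (r , mr , ar , r≢x , e)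

  same-key-alternating : ∀ {x y} → ¬ x ≡ y → (px : Partner x) (py : Partner y) →
                         key px ≡ key py → Alt x y
  same-key-alternating {x} {y} x≢y px py e with key-letter px | key-letter py
  ... | inj₁ ex | inj₁ ey = ⊥-elim (x≢y (FP.toℕ-injective (trans (≡-sym ex) (trans e ey))))
  ... | inj₁ ex | inj₂ (s , _ , as , _ , ey) with FP.toℕ-injective (trans (≡-sym ex) (trans e ey))
  ... | refl = alt-sym as
  same-key-alternating {x} {y} x≢y px py e | inj₂ (r , _ , ar , _ , ex) | inj₁ ey
    with FP.toℕ-injective (trans (≡-sym ey) (trans (≡-sym e) ex))
  ... | refl = ar
  same-key-alternating {x} {y} x≢y px py e | inj₂ (r , mr , ar , r≢x , ex) | inj₂ (s , _ , as , s≢y , ey)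
    with FP.toℕ-injective (trans (≡-sym ex) (trans e ey))
  ... | refl = ⊥-elim (x≢y (unique-neighbour mr (alt-sym ar) (alt-sym as)
                 (λ e → r≢x (≡-sym e)) (λ e → s≢y (≡-sym e))))

  remote-remote : ∀ {x y} → ¬ x ≡ y → (m : Often x) (p : Partner x) (m' : Often y) (p' : Partner y) →
                  Faithful (isRemote m p) (isRemote m' p')
  remote-remote {x} {y} x≢y m p m' p' = sound , complete
    where
    u = chordOf (isRemote m p)
    v = chordOf (isRemote m' p')
    sound : Intersect u v → Alt x y
    sound i with NP.<-cmp (key p) (key p')
    ... | tri< k<k' _ _ = ⊥-elim (precedes-disjoint u v (pairPoint-step k<k') i)
    ... | tri≈ _ e _ = same-key-alternating x≢y p p' e
    ... | tri> _ _ k'<k = ⊥-elim (follows-disjoint u v (pairPoint-step k'<k) i)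
    complete : Alt x y → Intersect u v
    complete a = inj₁ (cong pairPoint (alternating-same-key x≢y m m' p p' a))

  faithful : ∀ {x y} → ¬ x ≡ y → (kx : Kind x) (ky : Kind y) → Faithful kx ky
  faithful _ (isAbsent a) (isAbsent b) = sparse-sparse (absent-atMostOnce a) (absent-atMostOnce b) refl
  faithful _ (isAbsent a) (isOnce o) = sparse-sparse (absent-atMostOnce a) (once-atMostOnce o) refl
  faithful _ (isOnce o) (isAbsent a) = sparse-sparse (once-atMostOnce o) (absent-atMostOnce a) refl
  faithful _ (isOnce o) (isOnce o') = sparse-sparse (once-atMostOnce o) (once-atMostOnce o') refl
  faithful _ (isAbsent a) (isTwice t) = absent-twice a t
  faithful _ (isTwice t) (isAbsent a) = faithful-sym (absent-twice a t)
  faithful _ (isAbsent a) (isPendant pd) = absent-pendant a pd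
  faithful _ (isPendant pd) (isAbsent a) = faithful-sym (absent-pendant a pd)
  faithful _ (isAbsent a) (isRemote m p) = absent-remote a m p
  faithful _ (isRemote m p) (isAbsent a) = faithful-sym (absent-remote a m p)
  faithful x≢y (isOnce o) (isTwice t) = once-twice x≢y o t
  faithful x≢y (isTwice t) (isOnce o) = faithful-sym (once-twice (λ e → x≢y (≡-sym e)) o t)
  faithful _ (isOnce o) (isPendant pd) = once-pendant o pd
  faithful _ (isPendant pd) (isOnce o) = faithful-sym (once-pendant o pd)
  faithful _ (isOnce o) (isRemote m p) = once-remote o m p
  faithful _ (isRemote m p) (isOnce o) = faithful-sym (once-remote o m p)
  faithful x≢y (isTwice t) (isTwice t') = twice-twice x≢y t t'
  faithful x≢y (isTwice t) (isPendant pd) = twice-pendant x≢y t pd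
  faithful x≢y (isPendant pd) (isTwice t) = faithful-sym (twice-pendant (λ e → x≢y (≡-sym e)) t pd)
  faithful x≢y (isTwice t) (isRemote m p) = twice-remote x≢y t m p
  faithful x≢y (isRemote m p) (isTwice t) = faithful-sym (twice-remote (λ e → x≢y (≡-sym e)) t m p)
  faithful x≢y (isPendant pd) (isPendant pd') = pendant-pendant x≢y pd pd'
  faithful x≢y (isPendant pd) (isRemote m p) = pendant-remote x≢y pd m p
  faithful x≢y (isRemote m p) (isPendant pd) = faithful-sym (pendant-remote (λ e → x≢y (≡-sym e)) pd m p)
  faithful x≢y (isRemote m p) (isRemote m' p') = remote-remote x≢y m p m' p'

  -- Classify a letter; a neighbour of a frequent letter occurs at least twice.
  kind : ∀ x → Kind x
  kind x with occurrences x
  ... | absent a = isAbsent a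
  ... | single o = isOnce o
  ... | double t = isTwice t
  ... | many m with FP.any? (λ y → ¬? (y F.≟ x) ×-dec alt? x y)
  ... | no none = isRemote m (isolated λ z z≢x a → none (z , z≢x , a))
  ... | yes (y , y≢x , a) with occurrences y
  ... | absent b = ⊥-elim (often-not-separated m (absent-atMostOnce b) (proj₁ a))
  ... | single o = ⊥-elim (often-not-separated m (once-atMostOnce o) (proj₁ a))
  ... | double t = isPendant (pendant m y y≢x a t)
  ... | many m' = isRemote m (matched y y≢x a m')

  circle-model : IsCircleGraph G
  circle-model = (λ x → chordOf (kind x)) , λ x y x≢y →
    let open Faithful (faithful x≢y (kind x) (kind y))
        alt⇔adj = rep x y x≢y
    in (λ i → proj₁ alt⇔adj (sound i)) , (λ a → complete (proj₂ alt⇔adj a))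

corollary3p5 : (G : Graph) → Is123Representable G → IsCircleGraph G
corollary3p5 G (ℓ , ℓ-inj , w , rep , avoids) = Construction.circle-model G ℓ ℓ-inj w rep avoids
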